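{- For any graph $G$ and every integer $\ell\geq 2$, $$1\leq \frac{meg(G)}{meg(S^{\ell}_G)}\leq 2.$$ Moreover, the lower bound is tight (there are infinitely many graphs $G$ with $meg(G)/meg(S^{\ell}_G)=1$) and the upper bound is asymptotically tight (for every $\varepsilon>0$ there is a graph $G$ with $meg(G)/meg(S^{\ell}_G)>2-\varepsilon$).
   Context: All graphs are finite and simple. $S^{\ell}_G$ denotes the graph obtained from $G$ by subdividing every edge of $G$ exactly $\ell$ times (replacing each edge by a path with $\ell$ new internal vertices). A pair of vertices $u,v$ (or any vertex set containing them) monitors an edge $e$ if $e$ lies on every shortest $u$–$v$ path. A monitoring edge-geodetic set (MEG-set) of $G$ is a set $M\subseteq V(G)$ such that every edge of $G$ is monitored by some pair of vertices of $M$; $meg(G)$ is the minimum size of an MEG-set. -}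

module Defs where

open import Data.Nat using (ℕ; zero; suc; _≤_; _<_)
open import Data.Bool using (Bool; true; false; T)
open import Data.Fin using (Fin; toℕ)
open import Data.Product using (Σ; Σ-syntax; _×_; _,_; ∃)
open import Data.Sum using (_⊎_; inj₁; inj₂)
open import Data.List using (List; length)
open import Data.List.Membership.Propositional using (_∈_)
open import Data.List.Relation.Unary.Unique.Propositional using (Unique)
open import Relation.Binary.PropositionalEquality using (_≡_)

record Graph : Set₁ where
  field
    V   : Set
    Adj : V → V → Set

record SimpleGraph (n : ℕ) : Set where
  field
    adj    : Fin n → Fin n → Bool
    sym    : ∀ u v → adj u v ≡ adj v u
    irrefl : ∀ v → adj v v ≡ false

open SimpleGraph public

toGraph : ∀ {n} → SimpleGraph n → Graph
toGraph {n} G = record { V = Fin n ; Adj = λ u v → T (adj G u v) }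

module _ (G : Graph) where
  open Graph G

  data Walk : V → V → ℕ → Set where
    []  : ∀ {x} → Walk x x 0
    _∷_ : ∀ {x y z k} → Adj x y → Walk y z k → Walk x z (suc k)

  data UsesEdge (a b : V) : ∀ {x z k} → Walk x z k → Set where
    here→ : ∀ {z k} (e : Adj a b) (w : Walk b z k) → UsesEdge a b (e ∷ w)
    here← : ∀ {z k} (e : Adj b a) (w : Walk a z k) → UsesEdge a b (e ∷ w)
    there : ∀ {x y z k} (e : Adj x y) {w : Walk y z k} →
            UsesEdge a b w → UsesEdge a b (e ∷ w)

  -- A u–v walk of length k is shortest if no u–v walk is shorter
  -- (a shortest walk is a shortest path).
  IsShortest : ∀ {u v k} → Walk u v k → Set
  IsShortest {u} {v} {k} _ = ∀ m → Walk u v m → k ≤ m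

  Monitors : V → V → V → V → Set
  Monitors u v a b = ∀ k (w : Walk u v k) → IsShortest w → UsesEdge a b w

  IsMEGSet : List V → Set
  IsMEGSet M = ∀ a b → Adj a b →
    Σ[ u ∈ V ] Σ[ v ∈ V ] (u ∈ M × v ∈ M × Monitors u v a b)

  -- meg(G) = k : k is the minimum size of an MEG-set
  -- (sets are represented as duplicate-free lists).
  IsMeg : ℕ → Set
  IsMeg k =
    (Σ[ M ∈ List V ] (Unique M × length M ≡ k × IsMEGSet M)) ×
    (∀ (M : List V) → Unique M → IsMEGSet M → k ≤ length M)

  Connected : Set
  Connected = ∀ u v → Σ[ k ∈ ℕ ] Walk u v k

-- Subdivision S^ℓ_G.  Each edge {u,v} with u < v is replaced by the path
-- u — (e,0) — (e,1) — … — (e,ℓ-1) — v.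

module _ {n : ℕ} (ℓ : ℕ) (G : SimpleGraph n) where

  Edge : Set
  Edge = Σ[ u ∈ Fin n ] Σ[ v ∈ Fin n ] (toℕ u < toℕ v × T (adj G u v))

  src tgt : Edge → Fin n
  src (u , _ , _) = u
  tgt (_ , v , _) = v

  SubV : Set
  SubV = Fin n ⊎ (Edge × Fin ℓ)

  data SubArc : SubV → SubV → Set where
    first : ∀ e (i : Fin ℓ) → toℕ i ≡ 0 → SubArc (inj₁ (src e)) (inj₂ (e , i))
    mid   : ∀ e (i j : Fin ℓ) → suc (toℕ i) ≡ toℕ j →
            SubArc (inj₂ (e , i)) (inj₂ (e , j))
    last  : ∀ e (i : Fin ℓ) → suc (toℕ i) ≡ ℓ → SubArc (inj₂ (e , i)) (inj₁ (tgt e))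

  Subdivide : Graph
  Subdivide = record { V = SubV ; Adj = λ x y → SubArc x y ⊎ SubArc y x }

{-# OPTIONS --safe #-}
-- Subdividing an edge e = uv of G ℓ times replaces it by the path u — (e,0) — ⋯ — (e,ℓ-1) — v of
-- length L = ℓ + 1.  A walk of S^ℓ_G between original vertices projects to a walk of G at most
-- 1/L as long that uses only edges whose whole path it traverses.  So shortest walks lift and
-- project, an MEG-set of G is one of S^ℓ_G, and meg(S^ℓ_G) ≤ meg(G).  Conversely, replace every
-- vertex (e,i) of an MEG-set of S^ℓ_G by u and v.  A pair monitoring the first arc of an edge e
-- can be moved to original vertices one end at a time: a shortest walk from (f,i) with f ≠ e
-- leaves the path of f through one of its ends before reaching e, and if f = e both ends of e are
-- in the new set.  Monitoring from original vertices projects to G, so meg(G) ≤ 2 meg(S^ℓ_G).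
--
-- Paths have meg 2 before and after subdivision.  In the Möbius ladder on ten vertices every
-- vertex is forced, so meg = 10, but after subdivision the vertices (e,0) of the five edges e of
-- a perfect matching monitor everything: distance conditions on the ends of two matching edges
-- f, g make the edge between them part of every shortest (f,0)–(g,0) walk.  The ratio 2 is attained.
module Submission where

open import Defs hiding (sym)
open import Data.Nat using (ℕ; zero; suc; _≤_; _<_; _*_; _+_; _∸_; _%_; z≤n; s≤s; _≤?_; _<?_; _≡ᵇ_) renaming (_≟_ to _≟ℕ_)
open import Data.Nat.Properties hiding (_≟_)
open import Data.Nat.Induction using (<-rec)
open import Data.Nat.Tactic.RingSolver using (solve-∀)
open import Data.Bool using (Bool; true; false; T; not; _∨_)
open import Data.Bool.Properties using (T-irrelevant; T-∨; ∨-comm; ¬-not) renaming (_≟_ to _≟ᵇ_)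
open import Data.Fin using (Fin; toℕ; fromℕ; fromℕ<; _≟_; #_) renaming (zero to fzero; suc to fsuc)
open import Data.Fin.Properties using (toℕ-injective; toℕ<n; toℕ-fromℕ<; toℕ-fromℕ; all?; any?; injective⇒≤)
open import Data.Product using (Σ; Σ-syntax; _×_; _,_; proj₁; proj₂)
open import Data.Sum as Sum using (_⊎_; inj₁; inj₂; [_,_])
open import Data.Sum.Properties using (inj₁-injective)
open import Data.Empty using (⊥; ⊥-elim)
open import Data.Vec using ([]; _∷_) renaming (lookup to lookupᵛ)
open import Data.List using (List; []; _∷_; length; map; deduplicate; allFin; lookup)
open import Data.List.Properties using (length-map; length-deduplicate; length-tabulate)
open import Data.List.Membership.Propositional using (_∈_)
open import Data.List.Membership.Propositional.Properties using (∈-map⁺; ∈-deduplicate⁺; ∈-allFin)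
import Data.List.Membership.DecPropositional as DecMembership
open import Data.List.Relation.Unary.Any using (here; there; index)
open import Data.List.Relation.Unary.Any.Properties using (lookup-index)
open import Data.List.Relation.Unary.All using ([]; _∷_)
open import Data.List.Relation.Unary.AllPairs using ([]; _∷_)
open import Data.List.Relation.Unary.Unique.Propositional using (Unique)
open import Data.List.Relation.Unary.Unique.Propositional.Properties using (map⁺; allFin⁺)
open import Data.List.Relation.Unary.Unique.DecPropositional.Properties using (deduplicate-!)
open import Function using (id; _∘_; Equivalence)
open import Effect.Monad using (RawMonad)
open import Relation.Nullary using (¬_; Dec; yes; no; contradiction; ¬?; _×-dec_; _⊎-dec_; _→-dec_; map′; T?)
open import Relation.Nullary.Negation using (DoubleNegation; ¬¬-Monad)
open import Relation.Nullary.Decidable using (¬¬-excluded-middle; decidable-stable; from-yes)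
open import Relation.Binary.PropositionalEquality
  using (_≡_; _≢_; refl; sym; trans; cong; cong₂; subst; subst₂)
open import Level using (0ℓ)

open RawMonad (¬¬-Monad {a = 0ℓ}) using (_>>=_; pure; _<$>_)

¬¬-pull : {A B : Set} → (A → DoubleNegation B) → DoubleNegation (A → B)
¬¬-pull f k = k λ a → ⊥-elim (f a λ b → k λ _ → b)

¬¬-pull-Fin : ∀ {n} {P : Fin n → Set} → (∀ i → DoubleNegation (P i)) → DoubleNegation (∀ i → P i)
¬¬-pull-Fin {zero}      f = pure λ ()
¬¬-pull-Fin {suc n} {P} f = do
  p₀ ← f fzero
  p₊ ← ¬¬-pull-Fin {P = P ∘ fsuc} (f ∘ fsuc)
  pure λ where
    fzero    → p₀
    (fsuc i) → p₊ i

≡-or-not : ∀ a b → a ≡ b ⊎ a ≡ not b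
≡-or-not a b with a ≟ᵇ b
... | yes a≡b = inj₁ a≡b
... | no  a≢b = inj₂ (¬-not a≢b)

adj-sym : ∀ {n} (G : SimpleGraph n) {x y} → T (adj G x y) → T (adj G y x)
adj-sym G {x} {y} = subst T (SimpleGraph.sym G x y)

adjacent-monitors : ∀ {n} (G : SimpleGraph n) {x y} → T (adj G x y) → Monitors (toGraph G) x y x y
adjacent-monitors G t 0             []       _        = ⊥-elim (subst T (irrefl G _) t)
adjacent-monitors G t 1             (t′ ∷ []) _        = here→ t′ []
adjacent-monitors G t (suc (suc k)) _        shortest = contradiction (shortest 1 (t ∷ [])) λ { (s≤s ()) }

aligned-length≤1 : ∀ {ℓ M c c′} → M * suc ℓ + (c + c′) ≤ c + (suc ℓ + c′) → M ≤ 1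
aligned-length≤1 {ℓ} {M} {c} {c′} le =
  *-cancelʳ-≤ M 1 (suc ℓ) (+-cancelʳ-≤ (c + c′) (M * suc ℓ) (1 * suc ℓ) (≤-trans le (≤-reflexive (rearrange c (suc ℓ) c′))))
  where
  rearrange : ∀ c l c′ → c + (l + c′) ≡ 1 * l + (c + c′)
  rearrange = solve-∀

one-side-misaligned : ∀ {ℓ M c₁ c c′} → 2 ≤ M → M * suc ℓ + (c₁ + c′) ≤ c + (suc ℓ + c′) → c ≤ ℓ → ⊥
one-side-misaligned {ℓ} {M} {c₁} {c} {c′} 2≤M le c≤ℓ = <⇒≱ (s≤s c≤ℓ) (+-cancelʳ-≤ (suc ℓ) (suc ℓ) c chain)
  where
  chain : suc ℓ + suc ℓ ≤ c + suc ℓ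
  chain = begin
    suc ℓ + suc ℓ           ≡⟨ double ℓ ⟩
    2 * suc ℓ               ≤⟨ *-monoˡ-≤ (suc ℓ) 2≤M ⟩
    M * suc ℓ               ≤⟨ m≤m+n _ c₁ ⟩
    M * suc ℓ + c₁          ≤⟨ +-cancelʳ-≤ c′ _ _ (subst₂ _≤_ (sym (+-assoc _ c₁ c′)) (sym (+-assoc c (suc ℓ) c′)) le) ⟩
    c + suc ℓ               ∎
    where
    open ≤-Reasoning
    double : ∀ ℓ → suc ℓ + suc ℓ ≡ 2 * suc ℓ
    double = solve-∀

both-misaligned : ∀ {ℓ M c₁ c₂ c c′} → 3 ≤ M → M * suc ℓ + (c₁ + c₂) ≤ c + (suc ℓ + c′) → c ≤ ℓ → c′ ≤ ℓ → ⊥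
both-misaligned {ℓ} {M} {c₁} {c₂} {c} {c′} 3≤M le c≤ℓ c′≤ℓ = <⇒≱ (ℓ+[L+ℓ]<3L ℓ) chain
  where
  ℓ+[L+ℓ]<3L : ∀ ℓ → ℓ + (suc ℓ + ℓ) < 3 * suc ℓ
  ℓ+[L+ℓ]<3L ℓ = subst (ℓ + (suc ℓ + ℓ) <_) (three-L ℓ) (m<m+n _ (s≤s z≤n))
    where
    three-L : ∀ ℓ → ℓ + (suc ℓ + ℓ) + 2 ≡ 3 * suc ℓ
    three-L = solve-∀
  chain : 3 * suc ℓ ≤ ℓ + (suc ℓ + ℓ)
  chain = let open ≤-Reasoning in begin
    3 * suc ℓ               ≤⟨ *-monoˡ-≤ (suc ℓ) 3≤M ⟩
    M * suc ℓ               ≤⟨ m≤m+n _ (c₁ + c₂) ⟩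
    M * suc ℓ + (c₁ + c₂)   ≤⟨ le ⟩
    c + (suc ℓ + c′)        ≤⟨ +-mono-≤ c≤ℓ (+-monoʳ-≤ (suc ℓ) c′≤ℓ) ⟩
    ℓ + (suc ℓ + ℓ)         ∎

-- Walks

DistanceAtLeast : (G : Graph) → ℕ → Graph.V G → Graph.V G → Set
DistanceAtLeast G D x y = ∀ m → Walk G x y m → D ≤ m

module Walks (G : Graph) where
  open Graph G

  infixr 5 _++ʷ_

  _++ʷ_ : ∀ {x y z k m} → Walk G x y k → Walk G y z m → Walk G x z (k + m)
  []       ++ʷ w₂ = w₂
  (e ∷ w₁) ++ʷ w₂ = e ∷ (w₁ ++ʷ w₂)

  uses-∷⁻ : ∀ {a b x y z k} {e : Adj x y} {w : Walk G y z k} → UsesEdge G a b (e ∷ w) →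
            (a ≡ x × b ≡ y) ⊎ (a ≡ y × b ≡ x) ⊎ UsesEdge G a b w
  uses-∷⁻ (here→ _ _) = inj₁ (refl , refl)
  uses-∷⁻ (here← _ _) = inj₂ (inj₁ (refl , refl))
  uses-∷⁻ (there _ u) = inj₂ (inj₂ u)

  uses-∷⁺ : ∀ {a b x y z k} (e : Adj x y) (w : Walk G y z k) →
            (a ≡ x × b ≡ y) ⊎ (a ≡ y × b ≡ x) → UsesEdge G a b (e ∷ w)
  uses-∷⁺ e w (inj₁ (refl , refl)) = here→ e w
  uses-∷⁺ e w (inj₂ (refl , refl)) = here← e w

  uses-++⁻ : ∀ {a b x y z k m} (w₁ : Walk G x y k) {w₂ : Walk G y z m} →
             UsesEdge G a b (w₁ ++ʷ w₂) → UsesEdge G a b w₁ ⊎ UsesEdge G a b w₂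
  uses-++⁻ []       u           = inj₂ u
  uses-++⁻ (e ∷ w₁) (here→ _ _) = inj₁ (here→ e w₁)
  uses-++⁻ (e ∷ w₁) (here← _ _) = inj₁ (here← e w₁)
  uses-++⁻ (e ∷ w₁) (there _ u) = Sum.map₁ (there e) (uses-++⁻ w₁ u)

  uses-++⁺ˡ : ∀ {a b x y z k m} {w₁ : Walk G x y k} (w₂ : Walk G y z m) →
              UsesEdge G a b w₁ → UsesEdge G a b (w₁ ++ʷ w₂)
  uses-++⁺ˡ w₂ (here→ e w₁) = here→ e (w₁ ++ʷ w₂)
  uses-++⁺ˡ w₂ (here← e w₁) = here← e (w₁ ++ʷ w₂)
  uses-++⁺ˡ w₂ (there e u)  = there e (uses-++⁺ˡ w₂ u)

  uses-++⁺ʳ : ∀ {a b x y z k m} (w₁ : Walk G x y k) {w₂ : Walk G y z m} →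
              UsesEdge G a b w₂ → UsesEdge G a b (w₁ ++ʷ w₂)
  uses-++⁺ʳ []       u = u
  uses-++⁺ʳ (e ∷ w₁) u = there e (uses-++⁺ʳ w₁ u)

  uses-swap : ∀ {a b x z k} {w : Walk G x z k} → UsesEdge G a b w → UsesEdge G b a w
  uses-swap (here→ e w) = here← e w
  uses-swap (here← e w) = here→ e w
  uses-swap (there e u) = there e (uses-swap u)

  monitors-swap : ∀ {u v a b} → Monitors G u v a b → Monitors G u v b a
  monitors-swap mon k w shortest = uses-swap (mon k w shortest)

  monitors-suffix : ∀ {x y z a b k₁ k₂} → Monitors G x y a b →
                    (w₁ : Walk G x z k₁) (w₂ : Walk G z y k₂) → IsShortest G (w₁ ++ʷ w₂) →
                    ¬ UsesEdge G a b w₁ → Monitors G z y a b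
  monitors-suffix {k₁ = k₁} mon w₁ w₂ shortest w₁-avoids k w w-shortest =
    [ ⊥-elim ∘ w₁-avoids , id ] (uses-++⁻ w₁ (mon (k₁ + k) (w₁ ++ʷ w) extension-shortest))
    where
    extension-shortest : IsShortest G (w₁ ++ʷ w)
    extension-shortest m w′ = ≤-trans (+-monoʳ-≤ k₁ (w-shortest _ w₂)) (shortest m w′)

  MonitoredIn : List V → V → V → Set
  MonitoredIn M a b = Σ[ u ∈ V ] Σ[ v ∈ V ] (u ∈ M × v ∈ M × Monitors G u v a b)

  monitoredIn-swap : ∀ {M a b} → MonitoredIn M a b → MonitoredIn M b a
  monitoredIn-swap (u , v , u∈ , v∈ , mon) = u , v , u∈ , v∈ , monitors-swap mon

  megSet-size≥2 : ∀ {a b} → Adj a b → ∀ M → IsMEGSet G M → 2 ≤ length M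
  megSet-size≥2 {a} {b} t M meg with meg a b t
  ... | _ , _ , u∈ , v∈ , mon = atLeastTwo M u∈ v∈ mon
    where
    atLeastTwo : ∀ M {u v} → u ∈ M → v ∈ M → Monitors G u v a b → 2 ≤ length M
    atLeastTwo (_ ∷ _ ∷ _) _           _           _   = s≤s (s≤s z≤n)
    atLeastTwo (_ ∷ [])    (here refl) (here refl) mon with mon 0 [] (λ _ _ → z≤n)
    ... | ()

  ShortestWalk : V → V → Set
  ShortestWalk x y = Σ ℕ λ k → Σ (Walk G x y k) (IsShortest G)

  -- Only up to double negation: whether a shorter walk exists is not decidable in an arbitrary graph.
  shortest-exists : ∀ {x y k} → Walk G x y k → DoubleNegation (ShortestWalk x y)
  shortest-exists {x} {y} {k} = <-rec (λ k → Walk G x y k → DoubleNegation (ShortestWalk x y)) step k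
    where
    step : ∀ k → (∀ {j} → j < k → Walk G x y j → DoubleNegation (ShortestWalk x y)) →
           Walk G x y k → DoubleNegation (ShortestWalk x y)
    step k shorter w = ¬¬-excluded-middle {A = Σ ℕ λ j → j < k × Walk G x y j} >>= λ where
      (yes (j , j<k , w′)) → shorter j<k w′
      (no none)           → pure (k , w , λ m w′ → ≮⇒≥ λ m<k → none (m , m<k , w′))

module ReversibleWalks (G : Graph) (adj⁻¹ : ∀ {x y} → Graph.Adj G x y → Graph.Adj G y x) where
  open Graph G
  open Walks G

  infixl 5 _∷ʳ_

  _∷ʳ_ : ∀ {x y z k} → Walk G x y k → Adj y z → Walk G x z (suc k)
  []      ∷ʳ f = f ∷ []
  (e ∷ w) ∷ʳ f = e ∷ (w ∷ʳ f)

  reverse : ∀ {x y k} → Walk G x y k → Walk G y x k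
  reverse []      = []
  reverse (e ∷ w) = reverse w ∷ʳ adj⁻¹ e

  uses-∷ʳ⁻ : ∀ {a b x y z k} (w : Walk G x y k) {f : Adj y z} → UsesEdge G a b (w ∷ʳ f) →
             UsesEdge G a b w ⊎ (a ≡ y × b ≡ z) ⊎ (a ≡ z × b ≡ y)
  uses-∷ʳ⁻ []      (here→ _ _) = inj₂ (inj₁ (refl , refl))
  uses-∷ʳ⁻ []      (here← _ _) = inj₂ (inj₂ (refl , refl))
  uses-∷ʳ⁻ (e ∷ w) (here→ _ _) = inj₁ (here→ e w)
  uses-∷ʳ⁻ (e ∷ w) (here← _ _) = inj₁ (here← e w)
  uses-∷ʳ⁻ (e ∷ w) (there _ u) = Sum.map₁ (there e) (uses-∷ʳ⁻ w u)

  reverse-uses⁻ : ∀ {a b x y k} (w : Walk G x y k) → UsesEdge G a b (reverse w) → UsesEdge G a b w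
  reverse-uses⁻ (e ∷ w) u with uses-∷ʳ⁻ (reverse w) u
  ... | inj₁ u′                    = there e (reverse-uses⁻ w u′)
  ... | inj₂ (inj₁ (refl , refl)) = here← e w
  ... | inj₂ (inj₂ (refl , refl)) = here→ e w

  monitors-sym : ∀ {u v a b} → Monitors G u v a b → Monitors G v u a b
  monitors-sym mon k w shortest =
    reverse-uses⁻ w (mon k (reverse w) λ m w′ → shortest m (reverse w′))

-- Subdivisions

module Subdivision (d : ℕ) {n : ℕ} (G : SimpleGraph n) where

  ℓ L : ℕ
  ℓ = suc d
  L = suc ℓ

  𝔾 𝕊 : Graph
  𝔾 = toGraph G
  𝕊 = Subdivide ℓ G

  E : Set
  E = Edge ℓ G

  SV : Set
  SV = SubV ℓ G

  Arc : SV → SV → Set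
  Arc = SubArc ℓ G

  source target : E → Fin n
  source = src ℓ G
  target = tgt ℓ G

  arc-sym : ∀ {X Y} → Graph.Adj 𝕊 X Y → Graph.Adj 𝕊 Y X
  arc-sym = Sum.swap

  open Walks 𝕊
  open ReversibleWalks 𝕊 arc-sym
  open Walks 𝔾 using ()
    renaming (_++ʷ_ to _++ᴳ_; uses-∷⁻ to usesᴳ-∷⁻; uses-∷⁺ to usesᴳ-∷⁺; uses-++⁻ to usesᴳ-++⁻;
              MonitoredIn to MonitoredInᴳ; monitoredIn-swap to monitoredInᴳ-swap)
  open ReversibleWalks 𝔾 (adj-sym G) using ()
    renaming (reverse to reverseᴳ; reverse-uses⁻ to reverseᴳ-uses⁻)

  source<target : (e : E) → toℕ (source e) < toℕ (target e)
  source<target (_ , _ , lt , _) = lt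

  edge-adj : (e : E) → T (adj G (source e) (target e))
  edge-adj (_ , _ , _ , t) = t

  edge-≡ : (e e′ : E) → source e ≡ source e′ → target e ≡ target e′ → e ≡ e′
  edge-≡ (u , v , lt , t) (.u , .v , lt′ , t′) refl refl
    rewrite ≤-irrelevant lt lt′ | T-irrelevant t t′ = refl

  adj⇒toℕ-≢ : ∀ {x y} → T (adj G x y) → toℕ x ≢ toℕ y
  adj⇒toℕ-≢ {x} t eq with toℕ-injective eq
  ... | refl = subst T (irrefl G x) t

  Joins : E → Fin n → Fin n → Set
  Joins e x y = (source e ≡ x × target e ≡ y) ⊎ (source e ≡ y × target e ≡ x)

  edgeOf : ∀ x y → T (adj G x y) → Σ E λ e → Joins e x y
  edgeOf x y t with toℕ x <? toℕ y
  ... | yes x<y = (x , y , x<y , t) , inj₁ (refl , refl)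
  ... | no  x≮y = (y , x , ≤∧≢⇒< (≮⇒≥ x≮y) (adj⇒toℕ-≢ t ∘ sym) , adj-sym G t) , inj₂ (refl , refl)

  reversed-edges : (e f : E) → source f ≡ target e → target f ≡ source e → ⊥
  reversed-edges e f p q = <-asym (source<target e) (subst₂ (λ a b → toℕ a < toℕ b) p q (source<target f))

  joins-unique : ∀ {x y} (e f : E) → Joins e x y → Joins f x y → f ≡ e
  joins-unique e f (inj₁ (p , q)) (inj₁ (p′ , q′)) = edge-≡ f e (trans p′ (sym p)) (trans q′ (sym q))
  joins-unique e f (inj₂ (p , q)) (inj₂ (p′ , q′)) = edge-≡ f e (trans p′ (sym p)) (trans q′ (sym q))
  joins-unique e f (inj₁ (p , q)) (inj₂ (p′ , q′)) = ⊥-elim (reversed-edges e f (trans p′ (sym q)) (trans q′ (sym p)))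
  joins-unique e f (inj₂ (p , q)) (inj₁ (p′ , q′)) = ⊥-elim (reversed-edges e f (trans p′ (sym q)) (trans q′ (sym p)))

  uses-edge-∷⁻ : ∀ {x y z m} (e f : E) → Joins e x y → {t : T (adj G x y)} {w : Walk 𝔾 y z m} →
                 UsesEdge 𝔾 (source f) (target f) (t ∷ w) → f ≡ e ⊎ UsesEdge 𝔾 (source f) (target f) w
  uses-edge-∷⁻ e f j u with usesᴳ-∷⁻ u
  ... | inj₁ (p , q)        = inj₁ (joins-unique e f j (inj₁ (p , q)))
  ... | inj₂ (inj₁ (p , q)) = inj₁ (joins-unique e f j (inj₂ (p , q)))
  ... | inj₂ (inj₂ u′)      = inj₂ u′

  OnChain : E → SV → Set
  OnChain e X = Σ (Fin ℓ) λ i → X ≡ inj₂ (e , i)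

  arcEdge : ∀ {P Q} → Arc P Q → E
  arcEdge (first e _ _)   = e
  arcEdge (mid e _ _ _)   = e
  arcEdge (last e _ _)    = e

  arcPosition : ∀ {P Q} → Arc P Q → ℕ
  arcPosition (first _ _ _)   = 0
  arcPosition (mid _ i _ _)   = suc (toℕ i)
  arcPosition (last _ i _)    = suc (toℕ i)

  WithinChain : ∀ {X Y k} → E → Walk 𝕊 X Y k → Set
  WithinChain e W = ∀ {P Q} → UsesEdge 𝕊 P Q W → OnChain e P ⊎ OnChain e Q

  within-∷ : ∀ {e X Y Z k} {st : Graph.Adj 𝕊 X Y} {W : Walk 𝕊 Y Z k} →
             OnChain e X ⊎ OnChain e Y → WithinChain e W → WithinChain e (st ∷ W)
  within-∷ on-chain within u with uses-∷⁻ u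
  ... | inj₁ (refl , refl)        = on-chain
  ... | inj₂ (inj₁ (refl , refl)) = Sum.swap on-chain
  ... | inj₂ (inj₂ u′)            = within u′

  toTarget : (e : E) (r : ℕ) (i : Fin ℓ) → suc (toℕ i) + r ≡ ℓ →
             Walk 𝕊 (inj₂ (e , i)) (inj₁ (target e)) (suc r)
  toTarget e zero    i eq = inj₁ (last e i (trans (sym (+-identityʳ _)) eq)) ∷ []
  toTarget e (suc r) i eq = inj₁ (mid e i j (sym (toℕ-fromℕ< i+1<ℓ))) ∷ toTarget e r j eq′
    where
    eq″ : suc (suc (toℕ i)) + r ≡ ℓ
    eq″ = trans (sym (+-suc (suc (toℕ i)) r)) eq
    i+1<ℓ : suc (toℕ i) < ℓ
    i+1<ℓ = subst (suc (toℕ i) <_) eq″ (s≤s (m≤m+n (suc (toℕ i)) r))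
    j : Fin ℓ
    j = fromℕ< i+1<ℓ
    eq′ : suc (toℕ j) + r ≡ ℓ
    eq′ = trans (cong (λ z → suc z + r) (toℕ-fromℕ< i+1<ℓ)) eq″

  toSource : (e : E) (r : ℕ) (i : Fin ℓ) → toℕ i ≡ r → Walk 𝕊 (inj₂ (e , i)) (inj₁ (source e)) (suc r)
  toSource e zero    i eq = inj₂ (first e i eq) ∷ []
  toSource e (suc r) i eq = inj₂ (mid e j i (trans (cong suc (toℕ-fromℕ< r<ℓ)) (sym eq))) ∷ toSource e r j (toℕ-fromℕ< r<ℓ)
    where
    r<ℓ : r < ℓ
    r<ℓ = ≤-trans (≤-trans (n<1+n r) (≤-reflexive (sym eq))) (<⇒≤ (toℕ<n i))
    j : Fin ℓ
    j = fromℕ< r<ℓ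

  toTarget-within : ∀ e r i eq → WithinChain e (toTarget e r i eq)
  toTarget-within e zero    i eq = within-∷ (inj₁ (i , refl)) λ ()
  toTarget-within e (suc r) i eq = within-∷ (inj₁ (i , refl)) (toTarget-within e r _ _)

  firstVertex : E → SV
  firstVertex e = inj₂ (e , fzero)

  alongChain : (e : E) → Walk 𝕊 (inj₁ (source e)) (inj₁ (target e)) L
  alongChain e = inj₁ (first e fzero refl) ∷ toTarget e d fzero refl

  alongChain-within : ∀ e → WithinChain e (alongChain e)
  alongChain-within e = within-∷ (inj₂ (fzero , refl)) (toTarget-within e d fzero refl)

  walkAlong : ∀ {x y} (e : E) → Joins e x y → Walk 𝕊 (inj₁ x) (inj₁ y) L
  walkAlong e (inj₁ (refl , refl)) = alongChain e
  walkAlong e (inj₂ (refl , refl)) = reverse (alongChain e)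

  walkAlong-within : ∀ {x y} (e : E) (j : Joins e x y) → WithinChain e (walkAlong e j)
  walkAlong-within e (inj₁ (refl , refl)) = alongChain-within e
  walkAlong-within e (inj₂ (refl , refl)) = alongChain-within e ∘ reverse-uses⁻ (alongChain e)

  liftEdge : ∀ x y → T (adj G x y) → Walk 𝕊 (inj₁ x) (inj₁ y) L
  liftEdge x y t = walkAlong (proj₁ (edgeOf x y t)) (proj₂ (edgeOf x y t))

  liftWalk : ∀ {x y m} → Walk 𝔾 x y m → Walk 𝕊 (inj₁ x) (inj₁ y) (m * L)
  liftWalk []      = []
  liftWalk (t ∷ w) = liftEdge _ _ t ++ʷ liftWalk w

  liftWalk-uses : ∀ {x y m p j} (e : E) (w : Walk 𝔾 x y m) →
                  UsesEdge 𝕊 (inj₁ p) (inj₂ (e , j)) (liftWalk w) → UsesEdge 𝔾 (source e) (target e) w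
  liftWalk-uses e (_∷_ {x} {y} t w) u with uses-++⁻ (liftEdge x y t) u
  ... | inj₂ u′ = there t (liftWalk-uses e w u′)
  ... | inj₁ u′ with walkAlong-within (proj₁ (edgeOf x y t)) (proj₂ (edgeOf x y t)) u′
  ...   | inj₂ (_ , refl) = usesᴳ-∷⁺ t w (proj₂ (edgeOf x y t))

  ChainsCovered : ∀ {x y m X Y k} → Walk 𝔾 x y m → Walk 𝕊 X Y k → Set
  ChainsCovered w W = ∀ {P Q} (a : Arc P Q) →
    UsesEdge 𝔾 (source (arcEdge a)) (target (arcEdge a)) w → UsesEdge 𝕊 P Q W

  SegmentCovered : ∀ {X Y k} → (ℕ → Set) → E → Walk 𝕊 X Y k → Set
  SegmentCovered Pos e W = ∀ {P Q} (a : Arc P Q) → arcEdge a ≡ e → Pos (arcPosition a) → UsesEdge 𝕊 P Q W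

  record Projection {X t k} (W : Walk 𝕊 X (inj₁ t) k) (s : Fin n) (Short : ℕ → Set) : Set where
    constructor projection
    field
      {steps} : ℕ
      walk    : Walk 𝔾 s t steps
      short   : Short steps
      covers  : ChainsCovered walk W

  -- From (e,i) the source is i + 1 steps away and the target ℓ ∸ i; the target bound is stated
  -- without truncated subtraction.
  ExitViaSource ExitViaTarget : (e : E) (i : Fin ℓ) {t : Fin n} {k : ℕ} → Walk 𝕊 (inj₂ (e , i)) (inj₁ t) k → Set
  ExitViaSource e i {k = k} W =
    Projection W (source e) (λ m → m * L + suc (toℕ i) ≤ k) × SegmentCovered (_≤ toℕ i) e W
  ExitViaTarget e i {k = k} W =
    Projection W (target e) (λ m → m * L + ℓ ≤ k + toℕ i) × SegmentCovered (toℕ i <_) e W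

  firstArc : ∀ {P Q e i} (a : Arc P Q) → arcEdge a ≡ e → toℕ i ≡ 0 → arcPosition a ≡ 0 →
             P ≡ inj₁ (source e) × Q ≡ inj₂ (e , i)
  firstArc (first _ i′ eq′) refl eq _ with toℕ-injective (trans eq′ (sym eq))
  ... | refl = refl , refl

  midArc : ∀ {P Q e i j} (a : Arc P Q) → arcEdge a ≡ e → arcPosition a ≡ suc (toℕ i) → suc (toℕ i) ≡ toℕ j →
           P ≡ inj₂ (e , i) × Q ≡ inj₂ (e , j)
  midArc (mid _ i′ j′ eq′) refl p q with toℕ-injective (suc-injective p)
  ... | refl with toℕ-injective (trans (sym eq′) q)
  ...   | refl = refl , refl
  midArc {j = j} (last _ i′ eq′) refl p q = ⊥-elim (<-irrefl (sym (trans (sym eq′) (trans p q))) (toℕ<n j))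

  lastArc : ∀ {P Q e i} (a : Arc P Q) → arcEdge a ≡ e → suc (toℕ i) ≡ ℓ → ℓ ≤ arcPosition a →
            P ≡ inj₂ (e , i) × Q ≡ inj₁ (target e)
  lastArc (mid _ i′ j′ eq′) refl eq le = ⊥-elim (<⇒≱ (toℕ<n j′) (subst (ℓ ≤_) eq′ le))
  lastArc (last _ i′ eq′) refl eq le with toℕ-injective (suc-injective (trans eq′ (sym eq)))
  ... | refl = refl , refl

  prepend : ∀ {X Y t k s} {Short Short′ : ℕ → Set} (st : Graph.Adj 𝕊 X Y) {W : Walk 𝕊 Y (inj₁ t) k} →
            (∀ {m} → Short m → Short′ m) → Projection W s Short → Projection (st ∷ W) s Short′
  prepend st weaken (projection w short covers) = projection w (weaken short) λ a u → there st (covers a u)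

  module _ {e : E} {t : Fin n} {k : ℕ} where

    forward-viaSource : ∀ {i j} (eq : suc (toℕ i) ≡ toℕ j) {W : Walk 𝕊 (inj₂ (e , j)) (inj₁ t) k} →
                        ExitViaSource e j W → ExitViaSource e i (inj₁ (mid e i j eq) ∷ W)
    forward-viaSource {i} {j} eq (proj , seg) =
      prepend _ (λ {m} short → ≤-trans (+-monoʳ-≤ (m * L) i+1≤j+1) (≤-trans short (n≤1+n k))) proj ,
      λ a c p → there _ (seg a c (≤-trans p (≤-pred i+1≤j+1)))
      where
      i+1≤j+1 : suc (toℕ i) ≤ suc (toℕ j)
      i+1≤j+1 = ≤-trans (≤-reflexive eq) (n≤1+n _)

    forward-viaTarget : ∀ {i j} (eq : suc (toℕ i) ≡ toℕ j) {W : Walk 𝕊 (inj₂ (e , j)) (inj₁ t) k} →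
                        ExitViaTarget e j W → ExitViaTarget e i (inj₁ (mid e i j eq) ∷ W)
    forward-viaTarget {i} {j} eq {W} (proj , seg) =
      prepend _ (λ {m} → subst (m * L + ℓ ≤_) (trans (cong (k +_) (sym eq)) (+-suc k (toℕ i)))) proj ,
      covered
      where
      covered : SegmentCovered (toℕ i <_) e (inj₁ (mid e i j eq) ∷ W)
      covered a c p with arcPosition a ≟ℕ suc (toℕ i)
      ... | yes q = uses-∷⁺ _ W (inj₁ (midArc a c q eq))
      ... | no q  = there _ (seg a c (subst (_< arcPosition a) eq (≤∧≢⇒< p (q ∘ sym))))

    backward-viaSource : ∀ {i j} (eq : suc (toℕ j) ≡ toℕ i) {W : Walk 𝕊 (inj₂ (e , j)) (inj₁ t) k} →
                         ExitViaSource e j W → ExitViaSource e i (inj₂ (mid e j i eq) ∷ W)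
    backward-viaSource {i} {j} eq {W} (proj , seg) =
      prepend _ (λ {m} short → ≤-trans (≤-reflexive (trans (cong (λ z → m * L + suc z) (sym eq))
                                                          (+-suc (m * L) (suc (toℕ j)))))
                                        (s≤s short)) proj ,
      covered
      where
      covered : SegmentCovered (_≤ toℕ i) e (inj₂ (mid e j i eq) ∷ W)
      covered a c p with arcPosition a ≟ℕ toℕ i
      ... | yes q = uses-∷⁺ _ W (inj₂ (midArc a c (trans q (sym eq)) eq))
      ... | no q  = there _ (seg a c (≤-pred (subst (arcPosition a <_) (sym eq) (≤∧≢⇒< p q))))

    backward-viaTarget : ∀ {i j} (eq : suc (toℕ j) ≡ toℕ i) {W : Walk 𝕊 (inj₂ (e , j)) (inj₁ t) k} →
                         ExitViaTarget e j W → ExitViaTarget e i (inj₂ (mid e j i eq) ∷ W)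
    backward-viaTarget {i} {j} eq (proj , seg) =
      prepend _ (λ short → ≤-trans short (+-mono-≤ (n≤1+n k) j≤i)) proj ,
      λ a c p → there _ (seg a c (≤-trans (s≤s j≤i) p))
      where
      j≤i : toℕ j ≤ toℕ i
      j≤i = ≤-trans (n≤1+n _) (≤-reflexive eq)

    arriveTarget : ∀ {i} (eq : suc (toℕ i) ≡ ℓ) {W : Walk 𝕊 (inj₁ (target e)) (inj₁ t) k} →
                   Projection W (target e) (λ m → m * L ≤ k) → ExitViaTarget e i (inj₁ (last e i eq) ∷ W)
    arriveTarget {i} eq {W} proj =
      prepend _ (λ short → ≤-trans (+-monoˡ-≤ ℓ short)
                                   (≤-reflexive (trans (cong (k +_) (sym eq)) (+-suc k (toℕ i))))) proj ,
      λ a c p → uses-∷⁺ _ W (inj₁ (lastArc a c eq (subst (_≤ arcPosition a) eq p)))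

    arriveSource : ∀ {i} (eq : toℕ i ≡ 0) {W : Walk 𝕊 (inj₁ (source e)) (inj₁ t) k} →
                   Projection W (source e) (λ m → m * L ≤ k) → ExitViaSource e i (inj₂ (first e i eq) ∷ W)
    arriveSource eq {W} proj =
      prepend _ (λ {m} short → ≤-trans (≤-reflexive (trans (cong (λ z → m * L + suc z) eq) (+-comm (m * L) 1)))
                                       (s≤s short)) proj ,
      λ a c p → uses-∷⁺ _ W (inj₂ (firstArc a c eq (n≤0⇒n≡0 (subst (arcPosition a ≤_) eq p))))

    departSource : ∀ {i} (eq : toℕ i ≡ 0) {W : Walk 𝕊 (inj₂ (e , i)) (inj₁ t) k} →
                   ExitViaSource e i W ⊎ ExitViaTarget e i W →
                   Projection (inj₁ (first e i eq) ∷ W) (source e) (λ m → m * L ≤ suc k)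
    departSource eq (inj₁ (proj , _)) =
      prepend _ (λ {m} short → ≤-trans (m≤m+n (m * L) _) (≤-trans short (n≤1+n k))) proj
    departSource {i} eq {W} (inj₂ (projection {m} w short covers , seg)) =
      projection (edge-adj e ∷ w) (s≤s bound) covers′
      where
      bound : ℓ + m * L ≤ k
      bound = ≤-trans (≤-reflexive (+-comm ℓ (m * L)))
                      (≤-trans short (≤-reflexive (trans (cong (k +_) eq) (+-identityʳ k))))
      covers′ : ChainsCovered (edge-adj e ∷ w) (inj₁ (first e i eq) ∷ W)
      covers′ a u with uses-edge-∷⁻ e (arcEdge a) (inj₁ (refl , refl)) u
      ... | inj₂ u′ = there _ (covers a u′)
      ... | inj₁ c with arcPosition a ≟ℕ 0
      ...   | yes p = uses-∷⁺ _ W (inj₁ (firstArc a c eq p))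
      ...   | no p  = there _ (seg a c (subst (_< arcPosition a) (sym eq) (n≢0⇒n>0 p)))

    departTarget : ∀ {i} (eq : suc (toℕ i) ≡ ℓ) {W : Walk 𝕊 (inj₂ (e , i)) (inj₁ t) k} →
                   ExitViaSource e i W ⊎ ExitViaTarget e i W →
                   Projection (inj₂ (last e i eq) ∷ W) (target e) (λ m → m * L ≤ suc k)
    departTarget {i} eq (inj₂ (proj , _)) =
      prepend _ (λ {m} short → ≤-trans (+-cancelʳ-≤ ℓ (m * L) k (≤-trans short (+-monoʳ-≤ k (<⇒≤ (toℕ<n i)))))
                                       (n≤1+n k)) proj
    departTarget {i} eq {W} (inj₁ (projection {m} w short covers , seg)) =
      projection (adj-sym G (edge-adj e) ∷ w) (s≤s bound) covers′
      where
      bound : ℓ + m * L ≤ k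
      bound = ≤-trans (≤-reflexive (trans (+-comm ℓ (m * L)) (cong (m * L +_) (sym eq)))) short
      covers′ : ChainsCovered (adj-sym G (edge-adj e) ∷ w) (inj₂ (last e i eq) ∷ W)
      covers′ a u with uses-edge-∷⁻ e (arcEdge a) (inj₂ (refl , refl)) u
      ... | inj₂ u′ = there _ (covers a u′)
      ... | inj₁ c with arcPosition a ≤? toℕ i
      ...   | yes p = there _ (seg a c p)
      ...   | no p  = uses-∷⁺ _ W (inj₂ (lastArc a c eq (subst (_≤ arcPosition a) eq (≰⇒> p))))

  mutual
    project : ∀ {s t k} (W : Walk 𝕊 (inj₁ s) (inj₁ t) k) → Projection W s (λ m → m * L ≤ k)
    project []                        = projection [] z≤n λ _ ()
    project (inj₁ (first e i eq) ∷ W) = departSource eq (projectFromChain e i W)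
    project (inj₂ (last e i eq) ∷ W)  = departTarget eq (projectFromChain e i W)

    projectFromChain : ∀ e i {t k} (W : Walk 𝕊 (inj₂ (e , i)) (inj₁ t) k) → ExitViaSource e i W ⊎ ExitViaTarget e i W
    projectFromChain e i (inj₁ (mid _ _ j eq) ∷ W) =
      Sum.map (forward-viaSource eq) (forward-viaTarget eq) (projectFromChain e j W)
    projectFromChain e i (inj₂ (mid _ j _ eq) ∷ W) =
      Sum.map (backward-viaSource eq) (backward-viaTarget eq) (projectFromChain e j W)
    projectFromChain e i (inj₁ (last _ _ eq) ∷ W)  = inj₂ (arriveTarget eq (project W))
    projectFromChain e i (inj₂ (first _ _ eq) ∷ W) = inj₁ (arriveSource eq (project W))

  liftWalk-shortest : ∀ {x y k} (w : Walk 𝔾 x y k) → IsShortest 𝔾 w → IsShortest 𝕊 (liftWalk w)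
  liftWalk-shortest w shortest m W with project W
  ... | projection w′ short _ = ≤-trans (*-monoˡ-≤ L (shortest _ w′)) short

  monitors-lift : ∀ {x y P Q} (a : Arc P Q) → Monitors 𝔾 x y (source (arcEdge a)) (target (arcEdge a)) →
                  Monitors 𝕊 (inj₁ x) (inj₁ y) P Q
  monitors-lift a mon k W shortest with project W
  ... | projection w short covers = covers a (mon _ w w-shortest)
    where
    w-shortest : IsShortest 𝔾 w
    w-shortest m w′ = *-cancelʳ-≤ _ m L (≤-trans short (shortest (m * L) (liftWalk w′)))

  monitors-project : ∀ {x y j} (e : E) → Monitors 𝕊 (inj₁ x) (inj₁ y) (inj₁ (source e)) (inj₂ (e , j)) →
                     Monitors 𝔾 x y (source e) (target e)
  monitors-project e mon k w shortest = liftWalk-uses e w (mon (k * L) (liftWalk w) (liftWalk-shortest w shortest))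

  toBranch : (X : SV) → Σ (Fin n) λ x → Σ ℕ λ k → Walk 𝕊 X (inj₁ x) k
  toBranch (inj₁ x)       = x , 0 , []
  toBranch (inj₂ (e , i)) = source e , suc (toℕ i) , toSource e (toℕ i) i refl

  subdivision-connected : Connected 𝔾 → Connected 𝕊
  subdivision-connected connected X Y with toBranch X | toBranch Y
  ... | x , k₁ , w₁ | y , k₂ , w₂ with connected x y
  ...   | m , w = k₁ + (m * L + k₂) , w₁ ++ʷ liftWalk w ++ʷ reverse w₂

  megSet-lift : ∀ {M} → IsMEGSet 𝔾 M → IsMEGSet 𝕊 (map inj₁ M)
  megSet-lift {M} meg _ _ (inj₁ a) = lift-monitors a (meg _ _ (edge-adj (arcEdge a)))
    where
    lift-monitors : ∀ {P Q} (a : Arc P Q) → MonitoredInᴳ M (source (arcEdge a)) (target (arcEdge a)) →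
                    MonitoredIn (map inj₁ M) P Q
    lift-monitors a (x , y , x∈ , y∈ , mon) = inj₁ x , inj₁ y , ∈-map⁺ inj₁ x∈ , ∈-map⁺ inj₁ y∈ , monitors-lift a mon
  megSet-lift meg _ _ (inj₂ a) = monitoredIn-swap (megSet-lift meg _ _ (inj₁ a))

  meg-subdivision-≤ : ∀ {a b} → IsMeg 𝔾 a → IsMeg 𝕊 b → b ≤ a
  meg-subdivision-≤ ((M , unique , refl , meg) , _) (_ , minimal) =
    subst (_ ≤_) (length-map inj₁ M) (minimal (map inj₁ M) (map⁺ inj₁-injective unique) (megSet-lift meg))

  data ChainView (f : E) : ∀ {i Y k} → Walk 𝕊 (inj₂ (f , i)) Y k → Set where
    stays  : ∀ {i Y k} {W : Walk 𝕊 (inj₂ (f , i)) Y k} → OnChain f Y → WithinChain f W → ChainView f W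
    leaves : ∀ {i z Y k₁ k₂} (w₁ : Walk 𝕊 (inj₂ (f , i)) (inj₁ z) k₁) (w₂ : Walk 𝕊 (inj₁ z) Y k₂) →
             z ≡ source f ⊎ z ≡ target f → WithinChain f w₁ → ChainView f (w₁ ++ʷ w₂)

  chainView-∷ : ∀ {f i j Y k} (st : Graph.Adj 𝕊 (inj₂ (f , i)) (inj₂ (f , j))) {W : Walk 𝕊 (inj₂ (f , j)) Y k} →
                ChainView f W → ChainView f (st ∷ W)
  chainView-∷ {i = i} st (stays on within)        = stays on (within-∷ (inj₁ (i , refl)) within)
  chainView-∷ {i = i} st (leaves w₁ w₂ z within) = leaves (st ∷ w₁) w₂ z (within-∷ (inj₁ (i , refl)) within)

  chainView : ∀ f i {Y k} (W : Walk 𝕊 (inj₂ (f , i)) Y k) → ChainView f W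
  chainView f i []                            = stays (i , refl) λ ()
  chainView f i (st@(inj₁ (mid _ _ j _)) ∷ W) = chainView-∷ st (chainView f j W)
  chainView f i (st@(inj₂ (mid _ j _ _)) ∷ W) = chainView-∷ st (chainView f j W)
  chainView f i (st@(inj₁ (last _ _ _)) ∷ W)  = leaves (st ∷ []) W (inj₂ refl) (within-∷ (inj₁ (i , refl)) λ ())
  chainView f i (st@(inj₂ (first _ _ _)) ∷ W) = leaves (st ∷ []) W (inj₁ refl) (within-∷ (inj₁ (i , refl)) λ ())

  -- The upper bound

  edge-≟ : (e f : E) → Dec (e ≡ f)
  edge-≟ e f with source e ≟ source f | target e ≟ target f
  ... | yes p | yes q = yes (edge-≡ e f p q)
  ... | no ¬p | _     = no (¬p ∘ cong source)
  ... | _     | no ¬q = no (¬q ∘ cong target)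

  EndpointsIn : List (Fin n) → SV → Set
  EndpointsIn Ms (inj₁ x)       = x ∈ Ms
  EndpointsIn Ms (inj₂ (e , _)) = source e ∈ Ms × target e ∈ Ms

  endpointsIn-mono : ∀ {Ms Ms′} → (∀ {z} → z ∈ Ms → z ∈ Ms′) → ∀ X → EndpointsIn Ms X → EndpointsIn Ms′ X
  endpointsIn-mono ⊆ (inj₁ _) x∈         = ⊆ x∈
  endpointsIn-mono ⊆ (inj₂ _) (s∈ , t∈) = ⊆ s∈ , ⊆ t∈

  endpoints : List SV → List (Fin n)
  endpoints []                 = []
  endpoints (inj₁ x ∷ M)       = x ∷ endpoints M
  endpoints (inj₂ (e , _) ∷ M) = source e ∷ target e ∷ endpoints M

  endpoints-length : ∀ M → length (endpoints M) ≤ 2 * length M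
  endpoints-length []           = z≤n
  endpoints-length (inj₁ _ ∷ M) = ≤-trans (s≤s (endpoints-length M)) (≤-trans (n≤1+n _) (≤-reflexive (sym (*-suc 2 (length M)))))
  endpoints-length (inj₂ _ ∷ M) = ≤-trans (s≤s (s≤s (endpoints-length M))) (≤-reflexive (sym (*-suc 2 (length M))))

  endpoints-∈ : ∀ {X M} → X ∈ M → EndpointsIn (endpoints M) X
  endpoints-∈ {inj₁ _} (here refl) = here refl
  endpoints-∈ {inj₂ _} (here refl) = here refl , there (here refl)
  endpoints-∈ {X} {Y ∷ M} (there X∈) = endpointsIn-mono (endpoints-∷ Y) X (endpoints-∈ X∈)
    where
    endpoints-∷ : ∀ Y {z} → z ∈ endpoints M → z ∈ endpoints (Y ∷ M)
    endpoints-∷ (inj₁ _) z∈ = there z∈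
    endpoints-∷ (inj₂ _) z∈ = there (there z∈)

  module _ (connected : Connected 𝔾) (Ms : List (Fin n)) (e : E) where

    FirstArcMonitoredWith : SV → Set
    FirstArcMonitoredWith Y =
      (Σ (Fin n) λ u → u ∈ Ms × Monitors 𝕊 (inj₁ u) Y (inj₁ (source e)) (firstVertex e)) ⊎
      (source e ∈ Ms × target e ∈ Ms)

    avoids-firstArc : ∀ {f X Y k} {W : Walk 𝕊 X Y k} → f ≢ e → WithinChain f W →
                      ¬ UsesEdge 𝕊 (inj₁ (source e)) (firstVertex e) W
    avoids-firstArc f≢e within u with within u
    ... | inj₂ (_ , refl) = f≢e refl

    moveToBranch : ∀ X Y → EndpointsIn Ms X → Monitors 𝕊 X Y (inj₁ (source e)) (firstVertex e) →
                   DoubleNegation (FirstArcMonitoredWith Y)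
    moveToBranch (inj₁ x) Y x∈ mon = pure (inj₁ (x , x∈ , mon))
    moveToBranch (inj₂ (f , i)) Y ends mon with edge-≟ f e
    ... | yes refl = pure (inj₂ ends)
    ... | no f≢e   = do
      (k , W , shortest) ← shortest-exists (proj₂ (subdivision-connected connected (inj₂ (f , i)) Y))
      pure (exit k W shortest (chainView f i W))
      where
      endpoint∈ : ∀ {z} → z ≡ source f ⊎ z ≡ target f → z ∈ Ms
      endpoint∈ (inj₁ refl) = proj₁ ends
      endpoint∈ (inj₂ refl) = proj₂ ends
      exit : ∀ k (W : Walk 𝕊 (inj₂ (f , i)) Y k) → IsShortest 𝕊 W → ChainView f W → FirstArcMonitoredWith Y
      exit k W shortest (stays _ within) = ⊥-elim (avoids-firstArc f≢e within (mon k W shortest))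
      exit _ _ shortest (leaves {z = z} w₁ w₂ z-end within) =
        inj₁ (z , endpoint∈ z-end , monitors-suffix mon w₁ w₂ shortest (avoids-firstArc f≢e within))

    edgeMonitoredIn : ∀ X Y → EndpointsIn Ms X → EndpointsIn Ms Y →
                      Monitors 𝕊 X Y (inj₁ (source e)) (firstVertex e) →
                      DoubleNegation (MonitoredInᴳ Ms (source e) (target e))
    edgeMonitoredIn X Y endsX endsY mon = do
      inj₁ (u , u∈ , mon₁) ← moveToBranch X Y endsX mon
        where inj₂ ends → pure (byEndpoints ends)
      inj₁ (v , v∈ , mon₂) ← moveToBranch Y (inj₁ u) endsY (monitors-sym mon₁)
        where inj₂ ends → pure (byEndpoints ends)
      pure (v , u , v∈ , u∈ , monitors-project e mon₂)
      where
      byEndpoints : source e ∈ Ms × target e ∈ Ms → MonitoredInᴳ Ms (source e) (target e)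
      byEndpoints (s∈ , t∈) = source e , target e , s∈ , t∈ , adjacent-monitors G (edge-adj e)

  megSet-project : Connected 𝔾 → ∀ M → IsMEGSet 𝕊 M → DoubleNegation (IsMEGSet 𝔾 (deduplicate _≟_ (endpoints M)))
  megSet-project connected M meg = ¬¬-pull-Fin λ x → ¬¬-pull-Fin λ y → ¬¬-pull (monitoredEdge x y)
    where
    Ms : List (Fin n)
    Ms = deduplicate _≟_ (endpoints M)
    ends : ∀ {X} → X ∈ M → EndpointsIn Ms X
    ends {X} X∈ = endpointsIn-mono (∈-deduplicate⁺ _≟_) X (endpoints-∈ X∈)
    orient : ∀ e {x y} → Joins e x y → MonitoredInᴳ Ms (source e) (target e) → MonitoredInᴳ Ms x y
    orient _ (inj₁ (refl , refl)) = id
    orient _ (inj₂ (refl , refl)) = monitoredInᴳ-swap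
    monitoredEdge : ∀ x y → T (adj G x y) → DoubleNegation (MonitoredInᴳ Ms x y)
    monitoredEdge x y t with edgeOf x y t
    ... | e , joins with meg (inj₁ (source e)) (firstVertex e) (inj₁ (first e fzero refl))
    ...   | X , Y , X∈ , Y∈ , mon = orient e joins <$> edgeMonitoredIn connected Ms e X Y (ends X∈) (ends Y∈) mon

  meg-≤-2*size : Connected 𝔾 → ∀ {a} → IsMeg 𝔾 a → ∀ M → IsMEGSet 𝕊 M → a ≤ 2 * length M
  meg-≤-2*size connected {a} (_ , minimal) M meg =
    decidable-stable (a ≤? 2 * length M) (bound <$> megSet-project connected M meg)
    where
    bound : IsMEGSet 𝔾 (deduplicate _≟_ (endpoints M)) → a ≤ 2 * length M
    bound meg′ = ≤-trans (minimal _ (deduplicate-! _≟_ (endpoints M)) meg′)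
                         (≤-trans (length-deduplicate _≟_ (endpoints M)) (endpoints-length M))

  meg-≤-2*meg-subdivision : Connected 𝔾 → ∀ {a b} → IsMeg 𝔾 a → IsMeg 𝕊 b → a ≤ 2 * b
  meg-≤-2*meg-subdivision connected meg-a ((M , _ , refl , meg) , _) = meg-≤-2*size connected meg-a M meg

  meg-subdivision-bounds : Connected 𝔾 → ∀ {a b} → IsMeg 𝔾 a → IsMeg 𝕊 b → b ≤ a × a ≤ 2 * b
  meg-subdivision-bounds connected meg-G meg-S =
    meg-subdivision-≤ meg-G meg-S , meg-≤-2*meg-subdivision connected meg-G meg-S

  -- Monitoring from first subdivision vertices

  endpoint : E → Bool → Fin n
  endpoint f false = source f
  endpoint f true  = target f

  distToEndpoint : Bool → ℕ
  distToEndpoint false = 1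
  distToEndpoint true  = ℓ

  distToEndpoint≤ℓ : ∀ σ → distToEndpoint σ ≤ ℓ
  distToEndpoint≤ℓ false = s≤s z≤n
  distToEndpoint≤ℓ true  = ≤-refl

  TowardsEndpoint : Bool → ℕ → Set
  TowardsEndpoint false p = p ≤ 0
  TowardsEndpoint true  p = 1 ≤ p

  towardsEndpoint : ∀ f σ → Walk 𝕊 (firstVertex f) (inj₁ (endpoint f σ)) (distToEndpoint σ)
  towardsEndpoint f false = toSource f 0 fzero refl
  towardsEndpoint f true  = toTarget f d fzero refl

  ExitFromFirst : ∀ f {z k} → Walk 𝕊 (firstVertex f) (inj₁ z) k → Set
  ExitFromFirst f {k = k} W = Σ Bool λ σ →
    Projection W (endpoint f σ) (λ m → m * L + distToEndpoint σ ≤ k) × SegmentCovered (TowardsEndpoint σ) f W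

  projectFromFirst : ∀ f {z k} (W : Walk 𝕊 (firstVertex f) (inj₁ z) k) → ExitFromFirst f W
  projectFromFirst f {k = k} W with projectFromChain f fzero W
  ... | inj₁ (proj , seg) = false , proj , seg
  ... | inj₂ (projection w short covers , seg) = true , projection w (subst (_ ≤_) (+-identityʳ k) short) covers , seg

  joins-irrefl : ∀ e {x} → ¬ Joins e x x
  joins-irrefl e (inj₁ (p , q)) = <-irrefl (cong toℕ (trans p (sym q))) (source<target e)
  joins-irrefl e (inj₂ (p , q)) = <-irrefl (cong toℕ (trans p (sym q))) (source<target e)

  short-walk-uses : ∀ e {x y m} → Joins e x y → (U : Walk 𝔾 x y m) → m ≤ 1 → UsesEdge 𝔾 (source e) (target e) U
  short-walk-uses e joins []          _        = ⊥-elim (joins-irrefl e joins)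
  short-walk-uses e joins (t ∷ [])    _        = usesᴳ-∷⁺ t [] joins
  short-walk-uses e joins (_ ∷ _ ∷ _) (s≤s ())

  module Ports {f g : E} (g≢f : g ≢ f) (σ τ : Bool) (e : E) (joins : Joins e (endpoint f σ) (endpoint g τ))
               (far₁ : DistanceAtLeast 𝔾 2 (endpoint f (not σ)) (endpoint g τ))
               (far₂ : DistanceAtLeast 𝔾 2 (endpoint f σ) (endpoint g (not τ)))
               (far₃ : DistanceAtLeast 𝔾 3 (endpoint f (not σ)) (endpoint g (not τ))) where

    portLength : ℕ
    portLength = distToEndpoint σ + (L + distToEndpoint τ)

    portWalk : Walk 𝕊 (firstVertex f) (firstVertex g) portLength
    portWalk = towardsEndpoint f σ ++ʷ walkAlong e joins ++ʷ reverse (towardsEndpoint g τ)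

    -- A shortest (f,0)–(g,0) walk leaves f at an end σ₁ and g at an end τ₁ and projects to a walk
    -- of G between them; the distance hypotheses make every choice but (σ, τ) longer than portWalk,
    -- and for (σ, τ) the projected walk is the edge e.
    aligned : ∀ {σ₁ τ₁ M} → Walk 𝔾 (endpoint f σ₁) (endpoint g τ₁) M →
              M * L + (distToEndpoint σ₁ + distToEndpoint τ₁) ≤ portLength → σ₁ ≡ σ × τ₁ ≡ τ × M ≤ 1
    aligned {σ₁} {τ₁} {M} U bound with ≡-or-not σ₁ σ | ≡-or-not τ₁ τ
    ... | inj₁ refl | inj₁ refl = refl , refl , aligned-length≤1 bound
    ... | inj₂ refl | inj₁ refl = ⊥-elim (one-side-misaligned (far₁ _ U) bound (distToEndpoint≤ℓ σ))
    ... | inj₁ refl | inj₂ refl = ⊥-elim (one-side-misaligned (far₂ _ U) bound′ (distToEndpoint≤ℓ τ))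
      where
      swap-ends : ∀ a l b → a + (l + b) ≡ b + (l + a)
      swap-ends = solve-∀
      bound′ : M * L + (distToEndpoint (not τ) + distToEndpoint σ) ≤ distToEndpoint τ + (L + distToEndpoint σ)
      bound′ = subst₂ _≤_ (cong (M * L +_) (+-comm (distToEndpoint σ) _)) (swap-ends _ L _) bound
    ... | inj₂ refl | inj₂ refl =
      ⊥-elim (both-misaligned {c₁ = distToEndpoint (not σ)} (far₃ _ U) bound (distToEndpoint≤ℓ σ) (distToEndpoint≤ℓ τ))

    PortCovered : ∀ {P Q} → Arc P Q → Set
    PortCovered a = arcEdge a ≡ e ⊎ (arcEdge a ≡ f × TowardsEndpoint σ (arcPosition a))

    covered-by-exits : ∀ {z k₁ k₂} {w₁ : Walk 𝕊 (firstVertex f) (inj₁ z) k₁} {w₂ : Walk 𝕊 (inj₁ z) (firstVertex g) k₂} →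
                       k₁ + k₂ ≤ portLength → ExitFromFirst f w₁ → ExitFromFirst g (reverse w₂) →
                       ∀ {P Q} (a : Arc P Q) → PortCovered a → UsesEdge 𝕊 P Q (w₁ ++ʷ w₂)
    covered-by-exits {w₁ = w₁} {w₂} short
      (σ₁ , projection {m₁} u₁ short₁ covers₁ , seg₁) (τ₁ , projection {m₂} u₂ short₂ covers₂ , _) {P} {Q} a
      with aligned {σ₁} {τ₁} (u₁ ++ᴳ reverseᴳ u₂)
                   (≤-trans (≤-reflexive (split m₁ m₂ L (distToEndpoint σ₁) (distToEndpoint τ₁))) (≤-trans (+-mono-≤ short₁ short₂) short))
      where
      split : ∀ m₁ m₂ l c₁ c₂ → (m₁ + m₂) * l + (c₁ + c₂) ≡ (m₁ * l + c₁) + (m₂ * l + c₂)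
      split = solve-∀
    ... | refl , refl , M≤1 = [ on-e , on-f ]
      where
      on-e : arcEdge a ≡ e → UsesEdge 𝕊 P Q (w₁ ++ʷ w₂)
      on-e c with usesᴳ-++⁻ u₁ (subst (λ x → UsesEdge 𝔾 (source x) (target x) (u₁ ++ᴳ reverseᴳ u₂)) (sym c)
                                       (short-walk-uses e joins (u₁ ++ᴳ reverseᴳ u₂) M≤1))
      ... | inj₁ u = uses-++⁺ˡ w₂ (covers₁ a u)
      ... | inj₂ u = uses-++⁺ʳ w₁ (reverse-uses⁻ w₂ (covers₂ a (reverseᴳ-uses⁻ u₂ u)))
      on-f : arcEdge a ≡ f × TowardsEndpoint σ (arcPosition a) → UsesEdge 𝕊 P Q (w₁ ++ʷ w₂)
      on-f (c , p) = uses-++⁺ˡ w₂ (seg₁ a c p)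

    ports-monitor : ∀ {P Q} (a : Arc P Q) → PortCovered a → Monitors 𝕊 (firstVertex f) (firstVertex g) P Q
    ports-monitor a covered k W shortest with chainView f fzero W
    ... | stays (_ , refl) _ = ⊥-elim (g≢f refl)
    ... | leaves w₁ w₂ _ _   =
      covered-by-exits (shortest _ portWalk) (projectFromFirst f w₁) (projectFromFirst g (reverse w₂)) a covered

  joins-sym : ∀ e {x y} → Joins e x y → Joins e y x
  joins-sym _ = Sum.swap

  joins⇒adj : ∀ e {x y} → Joins e x y → T (adj G x y)
  joins⇒adj e (inj₁ (refl , refl)) = edge-adj e
  joins⇒adj e (inj₂ (refl , refl)) = adj-sym G (edge-adj e)

  joins-endpoints : ∀ e σ → Joins e (endpoint e σ) (endpoint e (not σ))
  joins-endpoints e false = inj₁ (refl , refl)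
  joins-endpoints e true  = inj₂ (refl , refl)

  joins⇒endpoints : ∀ e {x y} → Joins e x y → Σ Bool λ σ → endpoint e σ ≡ x × endpoint e (not σ) ≡ y
  joins⇒endpoints _ (inj₁ (p , q)) = false , p , q
  joins⇒endpoints _ (inj₂ (p , q)) = true , q , p

  endpoint-injective : ∀ e {σ τ} → endpoint e σ ≡ endpoint e τ → σ ≡ τ
  endpoint-injective e {false} {false} _ = refl
  endpoint-injective e {true}  {true}  _ = refl
  endpoint-injective e {false} {true}  p = ⊥-elim (<-irrefl (cong toℕ p) (source<target e))
  endpoint-injective e {true}  {false} p = ⊥-elim (<-irrefl (cong toℕ (sym p)) (source<target e))

  endpoint-cases : ∀ e σ τ → endpoint e τ ≡ endpoint e σ ⊎ endpoint e τ ≡ endpoint e (not σ)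
  endpoint-cases e σ τ with ≡-or-not τ σ
  ... | inj₁ refl = inj₁ refl
  ... | inj₂ refl = inj₂ refl

  towards : ∀ p → Σ Bool λ σ → TowardsEndpoint σ p
  towards zero    = false , z≤n
  towards (suc p) = true , s≤s z≤n

  module MatchingCover (mate : Fin n → Fin n) (matched : ∀ u → T (adj G u (mate u)))
                       (mate-involutive : ∀ u → mate (mate u) ≡ u)
                       (far-apart : ∀ u v → T (adj G u v) → v ≢ mate u →
                                    DistanceAtLeast 𝔾 2 (mate u) v × DistanceAtLeast 𝔾 2 u (mate v) ×
                                    DistanceAtLeast 𝔾 3 (mate u) (mate v))
                       (otherNeighbour : ∀ u → Σ[ v ∈ Fin n ] (T (adj G u v) × v ≢ mate u)) where

    matchEdge : Fin n → E
    matchEdge u = proj₁ (edgeOf u (mate u) (matched u))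

    matchVertex : Fin n → SV
    matchVertex = firstVertex ∘ matchEdge

    matchEdge-joins : ∀ u → Joins (matchEdge u) u (mate u)
    matchEdge-joins u = proj₂ (edgeOf u (mate u) (matched u))

    side : Fin n → Bool
    side u = proj₁ (joins⇒endpoints (matchEdge u) (matchEdge-joins u))

    side-endpoint : ∀ u → endpoint (matchEdge u) (side u) ≡ u
    side-endpoint u = proj₁ (proj₂ (joins⇒endpoints (matchEdge u) (matchEdge-joins u)))

    other-endpoint : ∀ u → endpoint (matchEdge u) (not (side u)) ≡ mate u
    other-endpoint u = proj₂ (proj₂ (joins⇒endpoints (matchEdge u) (matchEdge-joins u)))

    matchEdge-unique : ∀ e {u} → Joins e u (mate u) → matchEdge u ≡ e
    matchEdge-unique e {u} j = joins-unique e (matchEdge u) j (matchEdge-joins u)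

    matchVertex-mate : ∀ u → matchVertex (mate u) ≡ matchVertex u
    matchVertex-mate u = cong firstVertex (matchEdge-unique (matchEdge u)
      (subst (Joins (matchEdge u) (mate u)) (sym (mate-involutive u)) (joins-sym (matchEdge u) (matchEdge-joins u))))

    matchEdge-≢ : ∀ {u v} → T (adj G u v) → v ≢ mate u → matchEdge v ≢ matchEdge u
    matchEdge-≢ {u} {v} t v≢mate eq =
      [ (λ p → adj⇒toℕ-≢ t (cong toℕ (trans (sym (side-endpoint u)) (trans (sym p) v-endpoint))))
      , (λ p → v≢mate (trans (sym v-endpoint) (trans p (other-endpoint u))))
      ] (endpoint-cases (matchEdge u) (side u) (side v))
      where
      v-endpoint : endpoint (matchEdge u) (side v) ≡ v
      v-endpoint = subst (λ f → endpoint f (side v) ≡ v) eq (side-endpoint v)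

    pair-monitors : ∀ e {u v} → Joins e u v → v ≢ mate u → ∀ {P Q} (a : Arc P Q) →
                    arcEdge a ≡ e ⊎ (arcEdge a ≡ matchEdge u × TowardsEndpoint (side u) (arcPosition a)) →
                    Monitors 𝕊 (matchVertex u) (matchVertex v) P Q
    pair-monitors e {u} {v} j v≢mate =
      Ports.ports-monitor (matchEdge-≢ t v≢mate) (side u) (side v) e (at (Joins e) (side-endpoint u) (side-endpoint v) j)
        (at (DistanceAtLeast 𝔾 2) (other-endpoint u) (side-endpoint v) (proj₁ far))
        (at (DistanceAtLeast 𝔾 2) (side-endpoint u) (other-endpoint v) (proj₁ (proj₂ far)))
        (at (DistanceAtLeast 𝔾 3) (other-endpoint u) (other-endpoint v) (proj₂ (proj₂ far)))
      where
      t : T (adj G u v)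
      t = joins⇒adj e j
      far : DistanceAtLeast 𝔾 2 (mate u) v × DistanceAtLeast 𝔾 2 u (mate v) × DistanceAtLeast 𝔾 3 (mate u) (mate v)
      far = far-apart u v t v≢mate
      at : ∀ (R : Fin n → Fin n → Set) {x x′ y y′} → x′ ≡ x → y′ ≡ y → R x y → R x′ y′
      at R p q = subst₂ R (sym p) (sym q)

    -- An arc on the path of a matching edge lies between its first vertex and an end x, and is
    -- monitored from x and a neighbour of x outside the matching.
    matchingArc-monitored : ∀ {P Q} (a : Arc P Q) → target (arcEdge a) ≡ mate (source (arcEdge a)) →
                            ∀ σ → TowardsEndpoint σ (arcPosition a) →
                            Σ[ u ∈ Fin n ] Σ[ v ∈ Fin n ] Monitors 𝕊 (matchVertex u) (matchVertex v) P Q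
    matchingArc-monitored a matching σ towards-σ with otherNeighbour (endpoint (arcEdge a) σ)
    ... | y , t , y≢mate =
      x , y , pair-monitors (proj₁ (edgeOf x y t)) (proj₂ (edgeOf x y t)) y≢mate a
                            (inj₂ (sym x-edge , subst (λ s → TowardsEndpoint s (arcPosition a)) (sym x-side) towards-σ))
      where
      c : E
      c = arcEdge a
      x : Fin n
      x = endpoint c σ
      mate-x : ∀ σ → mate (endpoint c σ) ≡ endpoint c (not σ)
      mate-x false = sym matching
      mate-x true  = trans (cong mate matching) (mate-involutive _)
      x-edge : matchEdge x ≡ c
      x-edge = matchEdge-unique c (subst (Joins c x) (sym (mate-x σ)) (joins-endpoints c σ))
      x-side : side x ≡ σ
      x-side = endpoint-injective c (trans (cong (λ f → endpoint f (side x)) (sym x-edge)) (side-endpoint x))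

    cover : ∀ {P Q} (a : Arc P Q) → Σ[ u ∈ Fin n ] Σ[ v ∈ Fin n ] Monitors 𝕊 (matchVertex u) (matchVertex v) P Q
    cover a with target (arcEdge a) ≟ mate (source (arcEdge a))
    ... | no ¬matching = _ , _ , pair-monitors (arcEdge a) (inj₁ (refl , refl)) ¬matching a (inj₁ refl)
    ... | yes matching = matchingArc-monitored a matching (proj₁ (towards (arcPosition a))) (proj₂ (towards (arcPosition a)))

    megSet : ∀ M → (∀ u → matchVertex u ∈ M) → IsMEGSet 𝕊 M
    megSet M ∈M _ _ (inj₁ a) with cover a
    ... | u , v , mon = matchVertex u , matchVertex v , ∈M u , ∈M v , mon
    megSet M ∈M _ _ (inj₂ a) = monitoredIn-swap (megSet M ∈M _ _ (inj₁ a))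

-- Examples

module PathGraph (N : ℕ) where

  n : ℕ
  n = suc (suc N)

  Consecutive : Fin n → Fin n → Set
  Consecutive u v = suc (toℕ u) ≡ toℕ v

  consecutive? : Fin n → Fin n → Bool
  consecutive? u v = suc (toℕ u) ≡ᵇ toℕ v

  suc-≡ᵇ-false : ∀ m → (suc m ≡ᵇ m) ≡ false
  suc-≡ᵇ-false zero    = refl
  suc-≡ᵇ-false (suc m) = suc-≡ᵇ-false m

  path : SimpleGraph n
  path = record
    { adj    = λ u v → consecutive? u v ∨ consecutive? v u
    ; sym    = λ u v → ∨-comm (consecutive? u v) (consecutive? v u)
    ; irrefl = λ v → cong₂ _∨_ (suc-≡ᵇ-false (toℕ v)) (suc-≡ᵇ-false (toℕ v))
    }

  ℙ : Graph
  ℙ = toGraph path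

  path-adj⁻ : ∀ {u v} → T (adj path u v) → Consecutive u v ⊎ Consecutive v u
  path-adj⁻ t = Sum.map (≡ᵇ⇒≡ _ _) (≡ᵇ⇒≡ _ _) (Equivalence.to T-∨ t)

  path-adj⁺ : ∀ {u v} → Consecutive u v → T (adj path u v)
  path-adj⁺ p = Equivalence.from T-∨ (inj₁ (≡⇒≡ᵇ _ _ p))

  open Walks ℙ
  open ReversibleWalks ℙ (λ {x} {y} → adj-sym path {x} {y}) using (reverse)

  crossing : ∀ {a b} → Consecutive a b → ∀ {x z k} (w : Walk ℙ x z k) →
             toℕ x ≤ toℕ a → toℕ a < toℕ z → UsesEdge ℙ a b w
  crossing p []                x≤a a<z = ⊥-elim (<⇒≱ a<z x≤a)
  crossing {a} p (_∷_ {y = y} t w) x≤a a<z with toℕ y ≤? toℕ a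
  ... | yes y≤a = there t (crossing p w y≤a a<z)
  ... | no  y≰a with path-adj⁻ t
  ...   | inj₂ q = ⊥-elim (y≰a (≤-trans (≤-trans (n≤1+n _) (≤-reflexive q)) x≤a))
  ...   | inj₁ q with toℕ-injective (≤-antisym x≤a (≤-pred (subst (toℕ a <_) (sym q) (≰⇒> y≰a))))
  ...     | refl with toℕ-injective (trans (sym q) p)
  ...       | refl = here→ t w

  lastVertex : Fin n
  lastVertex = fromℕ (suc N)

  ends : List (Fin n)
  ends = fzero ∷ lastVertex ∷ []

  ends-unique : Unique ends
  ends-unique = ((λ ()) ∷ []) ∷ [] ∷ []

  ends-monitor : ∀ {a b} → Consecutive a b → Monitors ℙ fzero lastVertex a b
  ends-monitor {a} {b} p k w _ =
    crossing p w z≤n (subst (toℕ a <_) (sym (toℕ-fromℕ (suc N))) (≤-trans (≤-reflexive p) (≤-pred (toℕ<n b))))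

  path-megSet : IsMEGSet ℙ ends
  path-megSet a b t with path-adj⁻ t
  ... | inj₁ p = fzero , lastVertex , here refl , there (here refl) , ends-monitor p
  ... | inj₂ p = monitoredIn-swap (fzero , lastVertex , here refl , there (here refl) , ends-monitor p)

  ascend : ∀ r (x y : Fin n) → toℕ x + r ≡ toℕ y → Walk ℙ x y r
  ascend zero    x y p with toℕ-injective (trans (sym (+-identityʳ _)) p)
  ... | refl = []
  ascend (suc r) x y p = path-adj⁺ (sym (toℕ-fromℕ< x+1<n)) ∷ ascend r (fromℕ< x+1<n) y p′
    where
    x+1≤y : suc (toℕ x) ≤ toℕ y
    x+1≤y = subst (suc (toℕ x) ≤_) p (subst (_≤ toℕ x + suc r) (+-comm (toℕ x) 1) (+-monoʳ-≤ (toℕ x) (s≤s z≤n)))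
    x+1<n : suc (toℕ x) < n
    x+1<n = ≤-trans (s≤s x+1≤y) (toℕ<n y)
    p′ : toℕ (fromℕ< x+1<n) + r ≡ toℕ y
    p′ = trans (cong (_+ r) (toℕ-fromℕ< x+1<n)) (trans (sym (+-suc (toℕ x) r)) p)

  path-connected : Connected ℙ
  path-connected u v with toℕ u ≤? toℕ v
  ... | yes u≤v = _ , ascend (toℕ v ∸ toℕ u) u v (m+[n∸m]≡n u≤v)
  ... | no  u≰v = _ , reverse (ascend (toℕ u ∸ toℕ v) v u (m+[n∸m]≡n (<⇒≤ (≰⇒> u≰v))))

  edge₀₁ : T (adj path fzero (fsuc fzero))
  edge₀₁ = path-adj⁺ {fzero} {fsuc fzero} refl

  meg-path : IsMeg ℙ 2
  meg-path = (ends , ends-unique , refl , path-megSet) ,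
             λ M _ meg → megSet-size≥2 {fzero} {fsuc fzero} edge₀₁ M meg

  meg-path-subdivision : ∀ d → IsMeg (Subdivide (suc d) path) 2
  meg-path-subdivision d =
    (map inj₁ ends , map⁺ inj₁-injective ends-unique , refl , megSet-lift path-megSet) ,
    λ M _ meg → Walks.megSet-size≥2 (Subdivide (suc d) path) (inj₁ (first (fzero , fsuc fzero , s≤s z≤n , edge₀₁) fzero refl)) M meg
    where open Subdivision d path using (megSet-lift)

module FiniteGraph {n : ℕ} (G : SimpleGraph n) where

  𝔾 : Graph
  𝔾 = toGraph G

  open Walks 𝔾

  walk? : ∀ x y k → Dec (Walk 𝔾 x y k)
  walk? x y zero    = map′ (λ { refl → [] }) (λ { [] → refl }) (x ≟ y)
  walk? x y (suc k) = map′ (λ (_ , t , w) → t ∷ w) (λ { (t ∷ w) → _ , t , w })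
                           (any? λ z → T? (adj G x z) ×-dec walk? z y k)

  NoWalkShorter : ℕ → Fin n → Fin n → Set
  NoWalkShorter D x y = ∀ (m : Fin D) → ¬ Walk 𝔾 x y (toℕ m)

  noWalkShorter? : ∀ D x y → Dec (NoWalkShorter D x y)
  noWalkShorter? D x y = all? λ m → ¬? (walk? x y (toℕ m))

  noWalkShorter⇒distance : ∀ {D x y} → NoWalkShorter D x y → DistanceAtLeast 𝔾 D x y
  noWalkShorter⇒distance {D} none m w with m <? D
  ... | yes m<D = ⊥-elim (none (fromℕ< m<D) (subst (Walk 𝔾 _ _) (sym (toℕ-fromℕ< m<D)) w))
  ... | no  m≮D = ≮⇒≥ m≮D

  AvoidingWalk : Fin n → Fin n → Fin n → Fin n → ℕ → Set
  AvoidingWalk a b x y k = Σ (Walk 𝔾 x y k) λ w → ¬ UsesEdge 𝔾 a b w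

  avoidingWalk? : ∀ a b x y k → Dec (AvoidingWalk a b x y k)
  avoidingWalk? a b x y zero    = map′ (λ { refl → [] , λ () }) (λ { ([] , _) → refl }) (x ≟ y)
  avoidingWalk? a b x y (suc k) = map′
    (λ (_ , t , ¬ab , w , avoids) → t ∷ w , [ ¬ab ∘ inj₁ , [ ¬ab ∘ inj₂ , avoids ] ] ∘ uses-∷⁻)
    (λ { (t ∷ w , avoids) → _ , t , avoids ∘ uses-∷⁺ t w , w , avoids ∘ there t })
    (any? λ z → T? (adj G x z) ×-dec ¬? ((a ≟ x ×-dec b ≟ z) ⊎-dec (a ≟ z ×-dec b ≟ x)) ×-dec avoidingWalk? a b z y k)

  ShortestAvoiding : ℕ → Fin n → Fin n → Fin n → Fin n → Set
  ShortestAvoiding D a b x y = Σ[ k ∈ Fin D ] (NoWalkShorter (toℕ k) x y × AvoidingWalk a b x y (toℕ k))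

  shortestAvoiding? : ∀ D a b x y → Dec (ShortestAvoiding D a b x y)
  shortestAvoiding? D a b x y = any? λ k → noWalkShorter? (toℕ k) x y ×-dec avoidingWalk? a b x y (toℕ k)

  shortestAvoiding⇒¬monitors : ∀ {D a b x y} → ShortestAvoiding D a b x y → ¬ Monitors 𝔾 x y a b
  shortestAvoiding⇒¬monitors (_ , none , w , avoids) mon = avoids (mon _ w (noWalkShorter⇒distance none))

  Forced : ℕ → Fin n → Fin n → Set
  Forced D v w = ∀ x y → x ≢ v → y ≢ v → ShortestAvoiding D v w x y

  forced? : ∀ D v w → Dec (Forced D v w)
  forced? D v w = all? λ x → all? λ y → ¬? (x ≟ v) →-dec ¬? (y ≟ v) →-dec shortestAvoiding? D v w x y

  forced⇒∈ : ∀ {D v w} → Forced D v w → T (adj G v w) → ∀ M → IsMEGSet 𝔾 M → v ∈ M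
  forced⇒∈ {v = v} forced t M meg with meg _ _ t
  ... | x , y , x∈ , y∈ , mon with x ≟ v | y ≟ v
  ...   | yes refl | _        = x∈
  ...   | no _     | yes refl = y∈
  ...   | no x≢v   | no y≢v   = ⊥-elim (shortestAvoiding⇒¬monitors (forced x y x≢v y≢v) mon)

  covering⇒n≤length : ∀ M → (∀ v → v ∈ M) → n ≤ length M
  covering⇒n≤length M ∈M = injective⇒≤ {f = index ∘ ∈M} λ {u} {v} eq →
    trans (lookup-index (∈M u)) (trans (cong (lookup M) eq) (sym (lookup-index (∈M v))))

  meg-allForced : ∀ D → (∀ v → Σ[ w ∈ Fin n ] (T (adj G v w) × Forced D v w)) → IsMeg 𝔾 n
  meg-allForced D forced =
    (allFin n , allFin⁺ n , length-tabulate id , λ a b t → a , b , ∈-allFin a , ∈-allFin b , adjacent-monitors G t) ,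
    λ M _ meg → covering⇒n≤length M λ v → forced⇒∈ (proj₂ (proj₂ (forced v))) (proj₁ (proj₂ (forced v))) M meg

  connected? : ∀ D → Dec (∀ x y → Σ[ k ∈ Fin D ] Walk 𝔾 x y (toℕ k))
  connected? D = all? λ x → all? λ y → any? λ k → walk? x y (toℕ k)

  connected-within : ∀ {D} → (∀ x y → Σ[ k ∈ Fin D ] Walk 𝔾 x y (toℕ k)) → Connected 𝔾
  connected-within walks x y = _ , proj₂ (walks x y)

module MöbiusLadder where

  ladder-adj : Fin 10 → Fin 10 → Bool
  ladder-adj u v = (suc (toℕ u) % 10 ≡ᵇ toℕ v) ∨ (suc (toℕ v) % 10 ≡ᵇ toℕ u) ∨ ((toℕ u + 5) % 10 ≡ᵇ toℕ v)

  ladder : SimpleGraph 10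
  ladder = record
    { adj    = ladder-adj
    ; sym    = from-yes (all? λ u → all? λ v → ladder-adj u v ≟ᵇ ladder-adj v u)
    ; irrefl = from-yes (all? λ v → ladder-adj v v ≟ᵇ false)
    }

  open FiniteGraph ladder

  mate : Fin 10 → Fin 10
  mate = lookupᵛ (# 1 ∷ # 0 ∷ # 3 ∷ # 2 ∷ # 5 ∷ # 4 ∷ # 7 ∷ # 6 ∷ # 9 ∷ # 8 ∷ [])

  matched : ∀ u → T (ladder-adj u (mate u))
  matched = from-yes (all? λ u → T? (ladder-adj u (mate u)))

  mate-involutive : ∀ u → mate (mate u) ≡ u
  mate-involutive = from-yes (all? λ u → mate (mate u) ≟ u)

  otherNeighbour : ∀ u → Σ[ v ∈ Fin 10 ] (T (ladder-adj u v) × v ≢ mate u)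
  otherNeighbour = from-yes (all? λ u → any? λ v → T? (ladder-adj u v) ×-dec ¬? (v ≟ mate u))

  ladder-connected : Connected 𝔾
  ladder-connected = connected-within (from-yes (connected? 4))

  meg-ladder : IsMeg 𝔾 10
  meg-ladder = meg-allForced 4 (from-yes (all? λ v → any? λ w → T? (ladder-adj v w) ×-dec forced? 4 v w))

  far-apart-decided : ∀ u v → T (ladder-adj u v) → v ≢ mate u →
                      NoWalkShorter 2 (mate u) v × NoWalkShorter 2 u (mate v) × NoWalkShorter 3 (mate u) (mate v)
  far-apart-decided = from-yes (all? λ u → all? λ v → T? (ladder-adj u v) →-dec ¬? (v ≟ mate u) →-dec
                                 noWalkShorter? 2 (mate u) v ×-dec noWalkShorter? 2 u (mate v) ×-dec
                                 noWalkShorter? 3 (mate u) (mate v))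

  far-apart : ∀ u v → T (ladder-adj u v) → v ≢ mate u →
              DistanceAtLeast 𝔾 2 (mate u) v × DistanceAtLeast 𝔾 2 u (mate v) × DistanceAtLeast 𝔾 3 (mate u) (mate v)
  far-apart u v t v≢mate =
    let far₁ , far₂ , far₃ = far-apart-decided u v t v≢mate
    in noWalkShorter⇒distance far₁ , noWalkShorter⇒distance far₂ , noWalkShorter⇒distance far₃

  representatives : List (Fin 10)
  representatives = # 0 ∷ # 2 ∷ # 4 ∷ # 6 ∷ # 8 ∷ []

  representative : ∀ u → u ∈ representatives ⊎ mate u ∈ representatives
  representative = from-yes (all? λ u → (u ∈? representatives) ⊎-dec (mate u ∈? representatives))
    where open DecMembership (_≟_ {10}) using (_∈?_)

  module _ (d : ℕ) where
    open Subdivision d ladder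
      using (𝕊; SV; meg-≤-2*size; module MatchingCover)
    open MatchingCover mate matched mate-involutive far-apart otherNeighbour

    matchVertices : List SV
    matchVertices = map matchVertex representatives

    matchVertices-unique : Unique matchVertices
    matchVertices-unique =
      ((λ ()) ∷ (λ ()) ∷ (λ ()) ∷ (λ ()) ∷ []) ∷ ((λ ()) ∷ (λ ()) ∷ (λ ()) ∷ []) ∷
      ((λ ()) ∷ (λ ()) ∷ []) ∷ ((λ ()) ∷ []) ∷ [] ∷ []

    matchVertex∈ : ∀ u → matchVertex u ∈ matchVertices
    matchVertex∈ u with representative u
    ... | inj₁ u∈    = ∈-map⁺ matchVertex u∈
    ... | inj₂ mate∈ = subst (_∈ matchVertices) (matchVertex-mate u) (∈-map⁺ matchVertex mate∈)

    meg-ladder-subdivision : IsMeg 𝕊 5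
    meg-ladder-subdivision =
      (matchVertices , matchVertices-unique , refl , megSet matchVertices matchVertex∈) ,
      λ M _ meg → *-cancelˡ-≤ 2 (meg-≤-2*size ladder-connected meg-ladder M meg)

ratio-two-exceeds : ∀ p q b → 0 < p * b → 2 * q * b < q * (2 * b) + p * b
ratio-two-exceeds p q b 0<pb = subst (_< q * (2 * b) + p * b) (sym (reassociate q b)) (m<m+n _ 0<pb)
  where
  reassociate : ∀ q b → 2 * q * b ≡ q * (2 * b)
  reassociate = solve-∀

mainTheorem8 :
    (∀ (ℓ : ℕ) → 2 ≤ ℓ → ∀ (n : ℕ) (G : SimpleGraph n) → Connected (toGraph G) →
      ∀ (a b : ℕ) → IsMeg (toGraph G) a → IsMeg (Subdivide ℓ G) b →
      b ≤ a × a ≤ 2 * b)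
    ×
    (∀ (ℓ : ℕ) → 2 ≤ ℓ → ∀ (N : ℕ) →
      Σ[ n ∈ ℕ ] Σ[ G ∈ SimpleGraph n ] (N ≤ n × Connected (toGraph G) ×
        Σ[ a ∈ ℕ ] (IsMeg (toGraph G) a × IsMeg (Subdivide ℓ G) a)))
    ×
    (∀ (ℓ : ℕ) → 2 ≤ ℓ → ∀ (p q : ℕ) → 0 < p → 0 < q →
      Σ[ n ∈ ℕ ] Σ[ G ∈ SimpleGraph n ] (Connected (toGraph G) ×
        Σ[ a ∈ ℕ ] Σ[ b ∈ ℕ ] (IsMeg (toGraph G) a × IsMeg (Subdivide ℓ G) b ×
          2 * q * b < q * a + p * b)))
mainTheorem8 =
  -- every part already holds for ℓ ≥ 1
  (λ where (suc d) _ _ G connected _ _ → Subdivision.meg-subdivision-bounds d G connected) ,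
  (λ where (suc d) _ N → _ , path N , m≤n+m N 2 , path-connected N , 2 , meg-path N , meg-path-subdivision N d) ,
  (λ where (suc d) _ (suc p) q _ _ → _ , ladder , ladder-connected , 10 , 5 , meg-ladder , meg-ladder-subdivision d ,
                                     ratio-two-exceeds (suc p) q 5 (s≤s z≤n))
  where
  open PathGraph using (path; path-connected; meg-path; meg-path-subdivision)
  open MöbiusLadder
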